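{- Let $X$ be an ordered set containing a locally bounded commutative ordered monoid $M$ with distinguished element $0$ as an almost dense, bicofinal subset, with $0\leq 1$ in $M$, and suppose the multiplication on $M$ is preadmissible. Let $x,y\in X$ and fix $r_0,s_0,r_0',s_0'\in M$. Then for all $a,b,a',b'\in M$, if $r_0\leq x$, $a\leq x$, $x\leq s_0$, $x\leq b$, and $r_0'\leq y$, $a'\leq y$, $y\leq s_0'$, $y\leq b'$, then $$\min\{aa',ab',ba',bb'\}\leq\max\{r_0r_0',r_0s_0',s_0r_0',s_0s_0'\}.$$
   Context: All reasoning is constructive (no law of excluded middle). An ordered set is a set $X$ with a binary relation $<$ satisfying, for all $x,y,z$: asymmetry ($x<y$ implies not $y<x$), cotransitivity ($x<y$ implies $x<z$ or $z<y$), and negative antisymmetry (not $x<y$ and not $y<x$ imply $x=y$). Write $x\leq y$ for "not $y<x$", $x>y$ for $y<x$. A subset $S$ of $X$ (with the induced order) is almost dense if $x<y$ in $X$ implies $x\leq s<s'\leq y$ for some $s,s'\in S$, and bicofinal if for each $x\in X$ there are $s,s'\in S$ with $s\leq x\leq s'$. A set is finitely enumerable if it is empty or the image of $\{1,\dots,n\}$ for some positive integer $n$. A commutative ordered monoid with distinguished element $0$ is an ordered set $M$ with a distinguished element $0$ and a commutative monoid multiplication (identity $1$) such that $0<x$ and $0<y$ imply $0<xy$; it is locally bounded if every finitely enumerable subset has a minimum and a maximum element (min and max in the claim are taken in $M$). A multiplication on $M$ is preadmissible if for all $x,y,z\in M$: $0x=0=x0$; $x<y$ and $z>0$ imply $xz<yz$;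 $x<y$ and $z<0$ imply $xz>yz$. -}

module Defs where

open import Level using (Level; _⊔_; suc)
open import Data.Nat using (ℕ)
import Data.Fin as Fin
open Fin using (Fin)
open import Data.Product using (Σ; ∃; _×_; _,_)
open import Data.Sum using (_⊎_)
open import Relation.Nullary using (¬_)
open import Relation.Binary.PropositionalEquality using (_≡_)
open import Function.Definitions using (Injective)

record OrderedSet (c ℓ : Level) : Set (Level.suc (c ⊔ ℓ)) where
  field
    Carrier : Set c
    _<_     : Carrier → Carrier → Set ℓ
    asym    : ∀ {x y} → x < y → ¬ (y < x)
    cotrans : ∀ {x y} → x < y → ∀ z → (x < z) ⊎ (z < y)
    negAntisym : ∀ {x y} → ¬ (x < y) → ¬ (y < x) → x ≡ y

  _≤_ : Carrier → Carrier → Set ℓ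
  x ≤ y = ¬ (y < x)

-- A subset of X: a type M with an injection ι : M → X.
-- The order on M is the induced one: m <ₘ m' iff ι m < ι m'.
module Induced {c ℓ m : Level} (X : OrderedSet c ℓ) {M : Set m} (ι : M → OrderedSet.Carrier X) where
  open OrderedSet X

  _<ₘ_ : M → M → Set ℓ
  a <ₘ b = ι a < ι b

  _≤ₘ_ : M → M → Set ℓ
  a ≤ₘ b = ¬ (b <ₘ a)

  AlmostDense : Set (c ⊔ ℓ ⊔ m)
  AlmostDense = ∀ {x y} → x < y →
    Σ M λ s → Σ M λ s' → (x ≤ ι s) × (s <ₘ s') × (ι s' ≤ y)

  Bicofinal : Set (c ⊔ ℓ ⊔ m)
  Bicofinal = ∀ x → Σ M λ s → Σ M λ s' → (ι s ≤ x) × (x ≤ ι s')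

  IsMinOf : ∀ {n} → (Fin n → M) → M → Set (ℓ ⊔ m)
  IsMinOf f e = (∃ λ i → f i ≡ e) × (∀ j → e ≤ₘ f j)

  IsMaxOf : ∀ {n} → (Fin n → M) → M → Set (ℓ ⊔ m)
  IsMaxOf f e = (∃ λ i → f i ≡ e) × (∀ j → f j ≤ₘ e)

  LocallyBounded : Set (ℓ ⊔ m)
  LocallyBounded = ∀ (n : ℕ) (f : Fin (ℕ.suc n) → M) →
    (Σ M (IsMinOf f)) × (Σ M (IsMaxOf f))

  record IsCommOrderedMonoid (z : M) (one : M) (_·_ : M → M → M) : Set (ℓ ⊔ m) where
    field
      assoc     : ∀ a b d → (a · b) · d ≡ a · (b · d)
      comm      : ∀ a b → a · b ≡ b · a
      identityˡ : ∀ a → one · a ≡ a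
      identityʳ : ∀ a → a · one ≡ a
      pos-mul   : ∀ {a b} → z <ₘ a → z <ₘ b → z <ₘ (a · b)

  record IsPreadmissible (z : M) (_·_ : M → M → M) : Set (ℓ ⊔ m) where
    field
      zeroˡ : ∀ a → z · a ≡ z
      zeroʳ : ∀ a → a · z ≡ z
      mono-pos : ∀ {a b d} → a <ₘ b → z <ₘ d → (a · d) <ₘ (b · d)
      mono-neg : ∀ {a b d} → a <ₘ b → d <ₘ z → (b · d) <ₘ (a · d)

quad : ∀ {m} {M : Set m} → M → M → M → M → Fin 4 → M
quad p q r s Fin.zero = p
quad p q r s (Fin.suc Fin.zero) = q
quad p q r s (Fin.suc (Fin.suc Fin.zero)) = r
quad p q r s (Fin.suc (Fin.suc (Fin.suc Fin.zero))) = s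

-- Up to double negation the order is total, so x and y may be replaced by
-- elements u = max(a, r₀) ≤ x and u' = max(a', r₀') ≤ y of M.  For a fixed
-- factor v, the product u · v lies between lo · v and hi · v whenever u lies
-- between lo and hi (split on the sign of v, again up to double negation), so
-- u · u' is above every lower bound of the corners aa', ab', ba', bb' and
-- below every upper bound of r₀r₀', r₀s₀', s₀r₀', s₀s₀'.  Since the goal
-- mn ≤ mx is a negation, the double negations can be discharged.
module Submission where

open import Defs
open import Level using (Level)
open import Data.Fin using (Fin; zero; suc)
open import Data.Product using (Σ; _×_; _,_)
open import Data.Sum using (_⊎_; inj₁; inj₂)
open import Function.Base using (_∘_)
open import Function.Definitions using (Injective)
open import Relation.Nullary using (¬_; Dec; yes; no)
open import Relation.Nullary.Decidable using (¬¬-excluded-middle)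
open import Relation.Nullary.Negation using (¬¬-map; negated-stable)
open import Relation.Binary.PropositionalEquality using (_≡_; refl; subst)

module OrderedSetProperties {c ℓ : Level} (X : OrderedSet c ℓ) where
  open OrderedSet X

  ≤-refl : ∀ {x} → x ≤ x
  ≤-refl x<x = asym x<x x<x

  ≤-trans : ∀ {x y w} → x ≤ y → y ≤ w → x ≤ w
  ≤-trans {y = y} x≤y y≤w w<x with cotrans w<x y
  ... | inj₁ w<y = y≤w w<y
  ... | inj₂ y<x = x≤y y<x

  ¬¬-≤-total : ∀ x y → ¬ ¬ (x ≤ y ⊎ y ≤ x)
  ¬¬-≤-total x y = ¬¬-map total ¬¬-excluded-middle
    where
    total : Dec (y < x) → x ≤ y ⊎ y ≤ x
    total (yes y<x) = inj₂ (asym y<x)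
    total (no  y≮x) = inj₁ y≮x

  ¬¬-trichotomy : ∀ x y → ¬ ¬ (x < y ⊎ y < x ⊎ x ≡ y)
  ¬¬-trichotomy x y k =
    k (inj₂ (inj₂ (negAntisym (λ x<y → k (inj₁ x<y)) (λ y<x → k (inj₂ (inj₁ y<x))))))

  Between : Carrier → Carrier → Carrier → Set ℓ
  Between x y w = (x ≤ y × y ≤ w) ⊎ (w ≤ y × y ≤ x)

  ¬¬-between-lower : ∀ {l x y w} → l ≤ x → l ≤ w → ¬ ¬ Between x y w → l ≤ y
  ¬¬-between-lower {l} {x} {y} {w} l≤x l≤w = negated-stable ∘ ¬¬-map lower
    where
    lower : Between x y w → l ≤ y
    lower (inj₁ (x≤y , _)) = ≤-trans l≤x x≤y
    lower (inj₂ (w≤y , _)) = ≤-trans l≤w w≤y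

  ¬¬-between-upper : ∀ {x y w h} → x ≤ h → w ≤ h → ¬ ¬ Between x y w → y ≤ h
  ¬¬-between-upper {x} {y} {w} {h} x≤h w≤h = negated-stable ∘ ¬¬-map upper
    where
    upper : Between x y w → y ≤ h
    upper (inj₁ (_ , y≤w)) = ≤-trans y≤w w≤h
    upper (inj₂ (_ , y≤x)) = ≤-trans y≤x x≤h

module InducedProperties {c ℓ m : Level} (X : OrderedSet c ℓ) {M : Set m}
    {ι : M → OrderedSet.Carrier X} (ι-injective : Injective _≡_ _≡_ ι) where
  open OrderedSet X
  open OrderedSetProperties X
  open Induced X ι

  ≤ₘ-antisym : ∀ {p q} → p ≤ₘ q → q ≤ₘ p → p ≡ q
  ≤ₘ-antisym p≤q q≤p = ι-injective (negAntisym q≤p p≤q)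

  strictMono⇒mono : (f : M → M) → (∀ {p q} → p <ₘ q → f p <ₘ f q) →
                    ∀ {p q} → p ≤ₘ q → f p ≤ₘ f q
  strictMono⇒mono f mono {p} {q} p≤q fq<fp =
    ≤-refl (subst (λ t → f q <ₘ f t) p≡q fq<fp)
    where
    p≡q : p ≡ q
    p≡q = ≤ₘ-antisym p≤q (λ p<q → asym (mono p<q) fq<fp)

  strictAnti⇒anti : (f : M → M) → (∀ {p q} → p <ₘ q → f q <ₘ f p) →
                    ∀ {p q} → p ≤ₘ q → f q ≤ₘ f p
  strictAnti⇒anti f anti {p} {q} p≤q fp<fq =
    ≤-refl (subst (λ t → f t <ₘ f q) p≡q fp<fq)
    where
    p≡q : p ≡ q
    p≡q = ≤ₘ-antisym p≤q (λ p<q → asym (anti p<q) fp<fq)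

  ¬¬-upper-bound-below : ∀ {p q x} → ι p ≤ x → ι q ≤ x →
                         ¬ ¬ (Σ M λ u → p ≤ₘ u × q ≤ₘ u × ι u ≤ x)
  ¬¬-upper-bound-below {p} {q} {x} p≤x q≤x = ¬¬-map choose (¬¬-≤-total (ι p) (ι q))
    where
    choose : p ≤ₘ q ⊎ q ≤ₘ p → Σ M λ u → p ≤ₘ u × q ≤ₘ u × ι u ≤ x
    choose (inj₁ p≤q) = q , p≤q , ≤-refl , q≤x
    choose (inj₂ q≤p) = p , ≤-refl , q≤p , p≤x

module PreadmissibleProperties {c ℓ m : Level} (X : OrderedSet c ℓ) {M : Set m}
    {ι : M → OrderedSet.Carrier X} (ι-injective : Injective _≡_ _≡_ ι)
    {z : M} {_·_ : M → M → M} (·-comm : ∀ p q → p · q ≡ q · p)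
    (preadmissible : Induced.IsPreadmissible X ι z _·_) where
  open OrderedSet X
  open OrderedSetProperties X
  open Induced X ι
  open InducedProperties X ι-injective
  open IsPreadmissible preadmissible

  ·-zeroʳ-≤ : ∀ p q → (p · z) ≤ₘ (q · z)
  ·-zeroʳ-≤ p q rewrite zeroʳ p | zeroʳ q = ≤-refl

  ¬¬-·-betweenˡ : ∀ {lo u hi} → lo ≤ₘ u → u ≤ₘ hi →
                  ∀ v → ¬ ¬ Between (ι (lo · v)) (ι (u · v)) (ι (hi · v))
  ¬¬-·-betweenˡ {lo} {u} {hi} lo≤u u≤hi v = ¬¬-map sign-cases (¬¬-trichotomy (ι z) (ι v))
    where
    sign-cases : z <ₘ v ⊎ v <ₘ z ⊎ ι z ≡ ι v → Between (ι (lo · v)) (ι (u · v)) (ι (hi · v))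
    sign-cases (inj₁ 0<v) =
      inj₁ (strictMono⇒mono (_· v) (λ p<q → mono-pos p<q 0<v) lo≤u ,
            strictMono⇒mono (_· v) (λ p<q → mono-pos p<q 0<v) u≤hi)
    sign-cases (inj₂ (inj₁ v<0)) =
      inj₂ (strictAnti⇒anti (_· v) (λ p<q → mono-neg p<q v<0) u≤hi ,
            strictAnti⇒anti (_· v) (λ p<q → mono-neg p<q v<0) lo≤u)
    sign-cases (inj₂ (inj₂ ιz≡ιv)) with ι-injective ιz≡ιv
    ... | refl = inj₁ (·-zeroʳ-≤ lo u , ·-zeroʳ-≤ u hi)

  ¬¬-·-betweenʳ : ∀ {lo u hi} → lo ≤ₘ u → u ≤ₘ hi →
                  ∀ v → ¬ ¬ Between (ι (v · lo)) (ι (v · u)) (ι (v · hi))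
  ¬¬-·-betweenʳ {lo} {u} {hi} lo≤u u≤hi v
    rewrite ·-comm v lo | ·-comm v u | ·-comm v hi = ¬¬-·-betweenˡ lo≤u u≤hi v

  module _ {lo u hi lo' u' hi' : M} (lo≤u : lo ≤ₘ u) (u≤hi : u ≤ₘ hi)
           (lo'≤u' : lo' ≤ₘ u') (u'≤hi' : u' ≤ₘ hi') where

    corners : Fin 4 → M
    corners = quad (lo · lo') (lo · hi') (hi · lo') (hi · hi')

    ·-above-corner-lower-bound : ∀ {w} → (∀ j → w ≤ₘ corners j) → w ≤ₘ (u · u')
    ·-above-corner-lower-bound w≤ =
      ¬¬-between-lower
        (¬¬-between-lower (w≤ zero) (w≤ (suc zero)) (¬¬-·-betweenʳ lo'≤u' u'≤hi' lo))
        (¬¬-between-lower (w≤ (suc (suc zero))) (w≤ (suc (suc (suc zero))))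
          (¬¬-·-betweenʳ lo'≤u' u'≤hi' hi))
        (¬¬-·-betweenˡ lo≤u u≤hi u')

    ·-below-corner-upper-bound : ∀ {w} → (∀ j → corners j ≤ₘ w) → (u · u') ≤ₘ w
    ·-below-corner-upper-bound ≤w =
      ¬¬-between-upper
        (¬¬-between-upper (≤w zero) (≤w (suc zero)) (¬¬-·-betweenʳ lo'≤u' u'≤hi' lo))
        (¬¬-between-upper (≤w (suc (suc zero))) (≤w (suc (suc (suc zero))))
          (¬¬-·-betweenʳ lo'≤u' u'≤hi' hi))
        (¬¬-·-betweenˡ lo≤u u≤hi u')

lemma12 : ∀ {c ℓ m : Level} (X : OrderedSet c ℓ) (M : Set m)
    (ι : M → OrderedSet.Carrier X) → Injective _≡_ _≡_ ι →
    (z one : M) (_·_ : M → M → M) →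
    Induced.IsCommOrderedMonoid X ι z one _·_ →
    Induced.LocallyBounded X ι →
    Induced.AlmostDense X ι →
    Induced.Bicofinal X ι →
    Induced._≤ₘ_ X ι z one →
    Induced.IsPreadmissible X ι z _·_ →
    (x y : OrderedSet.Carrier X) (r₀ s₀ r₀' s₀' : M) →
    ∀ (a b a' b' : M) →
    OrderedSet._≤_ X (ι r₀) x → OrderedSet._≤_ X (ι a) x →
    OrderedSet._≤_ X x (ι s₀) → OrderedSet._≤_ X x (ι b) →
    OrderedSet._≤_ X (ι r₀') y → OrderedSet._≤_ X (ι a') y →
    OrderedSet._≤_ X y (ι s₀') → OrderedSet._≤_ X y (ι b') →
    ∀ (mn mx : M) →
    Induced.IsMinOf X ι (quad (a · a') (a · b') (b · a') (b · b')) mn →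
    Induced.IsMaxOf X ι (quad (r₀ · r₀') (r₀ · s₀') (s₀ · r₀') (s₀ · s₀')) mx →
    Induced._≤ₘ_ X ι mn mx
lemma12 X M ι ι-injective z one _·_ monoid _ _ _ _ preadmissible
  x y r₀ s₀ r₀' s₀' a b a' b'
  r₀≤x a≤x x≤s₀ x≤b r₀'≤y a'≤y y≤s₀' y≤b' mn mx (_ , mn≤) (_ , ≤mx) mx<mn =
  ¬¬-upper-bound-below r₀≤x a≤x λ (u , r₀≤u , a≤u , u≤x) →
  ¬¬-upper-bound-below r₀'≤y a'≤y λ (u' , r₀'≤u' , a'≤u' , u'≤y) →
  ≤-trans (·-above-corner-lower-bound a≤u (≤-trans u≤x x≤b) a'≤u' (≤-trans u'≤y y≤b') mn≤)
          (·-below-corner-upper-bound r₀≤u (≤-trans u≤x x≤s₀) r₀'≤u' (≤-trans u'≤y y≤s₀') ≤mx)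
          mx<mn
  where
  open OrderedSetProperties X
  open InducedProperties X ι-injective
  open PreadmissibleProperties X ι-injective
         (Induced.IsCommOrderedMonoid.comm monoid) preadmissible
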